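{- Let $a$ be an integer with $a\notin\{0,1,-1\}$, and let $p$ be an odd prime with $p\nmid 3a(2-a)(a^2-a+1)$ and $p\nmid a+1$. Let $\{v_n\}_{n\geq0}$ be defined by $v_0=2$, $v_1=2-a$, $v_{n+1}=(2-a)v_n-(a^2-a+1)v_{n-1}$ for $n\geq1$. Then $$\frac{v_p-(2-a)}{p}\equiv-\sum_{k=1}^{[p/3]}\frac{(-a)^{3k}}{k}-(a+1)q_p(a+1)\pmod p.$$
   Context: $[x]$ denotes the integer part of $x$. For an odd prime $p$ and an integer $x$ with $p\nmid x$, $q_p(x)=\frac{x^{p-1}-1}{p}$. Congruences modulo $p$ between rationals with denominators prime to $p$ are understood in the ring of $p$-integral rationals. -}

module Defs where

open import Data.Nat as ℕ using (ℕ; zero; suc)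
open import Data.Integer as ℤ using (ℤ; +_; -[1+_])
open import Data.Rational as ℚ using (ℚ; ↥_; ↧ₙ_; 0ℚ; _/_)
open import Data.Nat.Divisibility using (_∣_)
open import Data.Integer.Divisibility using () renaming (_∣_ to _∣ℤ_)
open import Data.Product using (_×_)
open import Relation.Nullary using (¬_)

v : ℤ → ℕ → ℤ
v a zero = + 2
v a (suc zero) = + 2 ℤ.- a
v a (suc (suc n)) = (+ 2 ℤ.- a) ℤ.* v a (suc n) ℤ.- (a ℤ.* a ℤ.- a ℤ.+ + 1) ℤ.* v a n

ι : ℤ → ℚ
ι z = z / 1

-- division of a rational by a natural number (only used with d prime, so d ≠ 0)
_÷ℕ_ : ℚ → ℕ → ℚ
x ÷ℕ zero = 0ℚ
x ÷ℕ suc n = x ℚ.* (+ 1 / suc n)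

q : ℕ → ℤ → ℚ
q p x = ι (x ℤ.^ (p ℕ.∸ 1) ℤ.- + 1) ÷ℕ p

Σ₁ : ℕ → (ℕ → ℚ) → ℚ
Σ₁ zero f = 0ℚ
Σ₁ (suc n) f = Σ₁ n f ℚ.+ f (suc n)

pIntegral : ℕ → ℚ → Set
pIntegral p x = ¬ (p ∣ ↧ₙ x)

_≡_[mod_] : ℚ → ℚ → ℕ → Set
x ≡ y [mod p ] = pIntegral p x × pIntegral p y × ((+ p) ∣ℤ (↥ (x ℚ.- y)))

{-# OPTIONS --safe #-}
-- With ω a primitive cube root of unity, v n = (1 + aω)ⁿ + (1 + aω²)ⁿ, hence
-- v n = Σₖ C(n,k) aᵏ χ k with χ k = ωᵏ + ω²ᵏ = 3·[3 ∣ k] − 1, an identity that follows from the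
-- recurrence by Pascal's rule alone, so ω never has to be adjoined. For n = p this gives
--   v p − (2 − a) + (a + 1)((a + 1)^(p−1) − 1) = 3 Σ_{1 ≤ j ≤ p/3} C(p,3j) a^(3j),
-- and 3 C(p,3j)/p = C(p−1,3j−1)/j with C(p−1,i) ≡ (−1)^i (mod p). Dividing by p turns the left side
-- into (v p − (2 − a))/p + (a + 1) q_p(a + 1) and the right side into −Σⱼ (−a)^(3j)/j mod p.
-- Fermat's little theorem makes q_p(a + 1) p-integral; congruences are handled in ℤ₍ₚ₎, with
-- rationals represented by fractions N/D such that p ∤ D.
module Submission where

open import Defs
open import Data.Nat as ℕ using (ℕ)
open import Data.Nat.DivMod using (_/_; _%_; m≡m%n+[m/n]*n; m%n<n)
open import Data.Nat.Primality using (Prime; ¬prime[0])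
open import Data.Integer as ℤ using (ℤ; +_; -[1+_])
open import Data.Integer.Divisibility using () renaming (_∣_ to _∣ℤ_)
open import Data.Rational as ℚ using (ℚ)
open import Relation.Binary.PropositionalEquality using (_≡_; _≢_)
open import Relation.Nullary using (¬_)
open import Data.Empty using (⊥-elim)

module BinomialSums where

  open import Data.Nat using (zero; suc; _<_)
  import Data.Nat.Properties as ℕP
  open import Data.Nat.Divisibility using (_∣0)
  open import Data.Nat.Combinatorics using (_C_; nC1≡n; nCk+nC[k+1]≡[n+1]C[k+1]; k>n⇒nCk≡0)
  open import Data.Nat.Tactic.RingSolver using () renaming (solve-∀ to solve-∀ℕ)
  open import Data.Integer using (0ℤ; 1ℤ; _+_; _*_; _-_; -_; _^_)
  import Data.Integer.Properties as ℤP
  open import Data.Integer.Divisibility.Signed using (∣ᵤ⇒∣; ∣m∣n⇒∣m+n) renaming (_∣_ to _∣ᵢ_)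
  open import Data.Integer.Tactic.RingSolver using (solve-∀)
  open import Function using (_∘_)
  open import Relation.Binary.PropositionalEquality using (refl; sym; trans; cong; cong₂; module ≡-Reasoning)
  open ≡-Reasoning

  suc-*-C : ∀ n k → suc k ℕ.* (suc n C suc k) ≡ suc n ℕ.* (n C k)
  suc-*-C zero    zero    = refl
  suc-*-C zero    (suc k) = ℕP.*-zeroʳ (suc (suc k))
  suc-*-C (suc n) zero    = trans (ℕP.+-identityʳ _) (trans (nC1≡n (suc (suc n))) (sym (ℕP.*-identityʳ _)))
  suc-*-C (suc n) (suc k) = begin
    suc (suc k) ℕ.* (suc (suc n) C suc (suc k))   ≡⟨ cong (suc (suc k) ℕ.*_) (sym (nCk+nC[k+1]≡[n+1]C[k+1] (suc n) (suc k))) ⟩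
    suc (suc k) ℕ.* (X ℕ.+ W)                     ≡⟨ distribute k X W ⟩
    X ℕ.+ suc k ℕ.* X ℕ.+ suc (suc k) ℕ.* W       ≡⟨ cong₂ (λ u w → X ℕ.+ u ℕ.+ w) (suc-*-C n k) (suc-*-C n (suc k)) ⟩
    X ℕ.+ suc n ℕ.* (n C k) ℕ.+ suc n ℕ.* (n C suc k) ≡⟨ collect n X (n C k) (n C suc k) ⟩
    X ℕ.+ suc n ℕ.* (n C k ℕ.+ n C suc k)         ≡⟨ cong (λ y → X ℕ.+ suc n ℕ.* y) (nCk+nC[k+1]≡[n+1]C[k+1] n k) ⟩
    suc (suc n) ℕ.* X                             ∎
    where
    X = suc n C suc k
    W = suc n C suc (suc k)
    distribute : ∀ k X W → suc (suc k) ℕ.* (X ℕ.+ W) ≡ X ℕ.+ suc k ℕ.* X ℕ.+ suc (suc k) ℕ.* W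
    distribute = solve-∀ℕ
    collect : ∀ n X Y Z → X ℕ.+ suc n ℕ.* Y ℕ.+ suc n ℕ.* Z ≡ X ℕ.+ suc n ℕ.* (Y ℕ.+ Z)
    collect = solve-∀ℕ

  ∑< : ℕ → (ℕ → ℤ) → ℤ
  ∑< zero    f = 0ℤ
  ∑< (suc n) f = ∑< n f + f n

  ∑<-cong : ∀ n {f g : ℕ → ℤ} → (∀ k → f k ≡ g k) → ∑< n f ≡ ∑< n g
  ∑<-cong zero    f≡g = refl
  ∑<-cong (suc n) f≡g = cong₂ _+_ (∑<-cong n f≡g) (f≡g n)

  ∑<-suc : ∀ n f → ∑< (suc n) f ≡ f 0 + ∑< n (f ∘ suc)
  ∑<-suc zero    f = ℤP.+-comm 0ℤ (f 0)
  ∑<-suc (suc n) f = begin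
    ∑< (suc n) f + f (suc n)               ≡⟨ cong (λ s → s + f (suc n)) (∑<-suc n f) ⟩
    f 0 + ∑< n (f ∘ suc) + f (suc n)       ≡⟨ ℤP.+-assoc (f 0) _ _ ⟩
    f 0 + (∑< n (f ∘ suc) + f (suc n))     ∎

  ∑<-+ : ∀ n (f g : ℕ → ℤ) → ∑< n (λ k → f k + g k) ≡ ∑< n f + ∑< n g
  ∑<-+ zero    f g = refl
  ∑<-+ (suc n) f g = trans (cong (λ s → s + (f n + g n)) (∑<-+ n f g)) (interchange (∑< n f) (∑< n g) (f n) (g n))
    where
    interchange : ∀ a b c d → a + b + (c + d) ≡ a + c + (b + d)
    interchange = solve-∀

  ∑<-*ˡ : ∀ n c (f : ℕ → ℤ) → ∑< n (λ k → c * f k) ≡ c * ∑< n f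
  ∑<-*ˡ zero    c f = sym (ℤP.*-zeroʳ c)
  ∑<-*ˡ (suc n) c f = trans (cong (λ s → s + c * f n) (∑<-*ˡ n c f)) (sym (ℤP.*-distribˡ-+ c (∑< n f) (f n)))

  ∑<-∣ : ∀ {d} n {f} → (∀ {k} → k < n → d ∣ᵢ f k) → d ∣ᵢ ∑< n f
  ∑<-∣ zero    _   = ∣ᵤ⇒∣ (_ ∣0)
  ∑<-∣ (suc n) d∣f = ∣m∣n⇒∣m+n (∑<-∣ n (d∣f ∘ ℕP.m<n⇒m<1+n)) (d∣f ℕP.≤-refl)

  binomialSum : ℤ → (ℕ → ℤ) → ℕ → ℤ
  binomialSum a c n = ∑< (suc n) (λ k → + (n C k) * a ^ k * c k)

  binomialSum-suc : ∀ a c n →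
    binomialSum a c (suc n) ≡ binomialSum a c n + a * binomialSum a (c ∘ suc) n
  binomialSum-suc a c n = begin
    ∑< (suc (suc n)) F                                             ≡⟨ ∑<-suc (suc n) F ⟩
    G 0 + ∑< (suc n) (F ∘ suc)                                     ≡⟨ cong (_+_ (G 0)) (∑<-cong (suc n) pascal) ⟩
    G 0 + ∑< (suc n) (λ k → a * H k + G (suc k))                   ≡⟨ cong (_+_ (G 0)) (∑<-+ (suc n) _ _) ⟩
    G 0 + (∑< (suc n) (λ k → a * H k) + ∑< (suc n) (G ∘ suc))
      ≡⟨ cong (λ s → G 0 + (s + ∑< (suc n) (G ∘ suc))) (∑<-*ˡ (suc n) a H) ⟩
    G 0 + (a * ∑< (suc n) H + ∑< (suc n) (G ∘ suc))                ≡⟨ rearrange (G 0) _ _ ⟩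
    G 0 + ∑< (suc n) (G ∘ suc) + a * ∑< (suc n) H                  ≡⟨ cong (λ s → s + a * ∑< (suc n) H) (sym (∑<-suc (suc n) G)) ⟩
    ∑< (suc n) G + G (suc n) + a * ∑< (suc n) H                    ≡⟨ cong (λ g → ∑< (suc n) G + g + a * ∑< (suc n) H) top-vanishes ⟩
    ∑< (suc n) G + 0ℤ + a * ∑< (suc n) H                           ≡⟨ cong (λ s → s + a * ∑< (suc n) H) (ℤP.+-identityʳ (∑< (suc n) G)) ⟩
    ∑< (suc n) G + a * ∑< (suc n) H                                ∎
    where
    F G H : ℕ → ℤ
    F k = + (suc n C k) * a ^ k * c k
    G k = + (n C k) * a ^ k * c k
    H k = + (n C k) * a ^ k * c (suc k)
    distribute : ∀ x y a b e → (x + y) * (a * b) * e ≡ a * (x * b * e) + y * (a * b) * e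
    distribute = solve-∀
    pascal : ∀ k → F (suc k) ≡ a * H k + G (suc k)
    pascal k = begin
      + (suc n C suc k) * (a * a ^ k) * c (suc k)
        ≡⟨ cong (λ m → + m * (a * a ^ k) * c (suc k)) (sym (nCk+nC[k+1]≡[n+1]C[k+1] n k)) ⟩
      + (n C k ℕ.+ n C suc k) * (a * a ^ k) * c (suc k)
        ≡⟨ cong (λ m → m * (a * a ^ k) * c (suc k)) (ℤP.pos-+ (n C k) (n C suc k)) ⟩
      (+ (n C k) + + (n C suc k)) * (a * a ^ k) * c (suc k)
        ≡⟨ distribute (+ (n C k)) (+ (n C suc k)) a (a ^ k) (c (suc k)) ⟩
      a * H k + G (suc k) ∎
    rearrange : ∀ x y z → x + (y + z) ≡ x + z + y
    rearrange = solve-∀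
    top-vanishes : G (suc n) ≡ 0ℤ
    top-vanishes = begin
      + (n C suc n) * a ^ suc n * c (suc n) ≡⟨ cong (λ m → + m * a ^ suc n * c (suc n)) (k>n⇒nCk≡0 (ℕP.n<1+n n)) ⟩
      0ℤ * a ^ suc n * c (suc n)            ≡⟨ cong (λ x → x * c (suc n)) (ℤP.*-zeroˡ (a ^ suc n)) ⟩
      0ℤ * c (suc n)                        ≡⟨ ℤP.*-zeroˡ (c (suc n)) ⟩
      0ℤ                                    ∎

  binomialSum-cong : ∀ a n {c d : ℕ → ℤ} → (∀ k → c k ≡ d k) → binomialSum a c n ≡ binomialSum a d n
  binomialSum-cong a n c≡d = ∑<-cong (suc n) (λ k → cong (λ x → + (n C k) * a ^ k * x) (c≡d k))

  binomialSum-+ : ∀ a (c d : ℕ → ℤ) n →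
    binomialSum a (λ k → c k + d k) n ≡ binomialSum a c n + binomialSum a d n
  binomialSum-+ a c d n =
    trans (∑<-cong (suc n) (λ k → ℤP.*-distribˡ-+ (+ (n C k) * a ^ k) (c k) (d k))) (∑<-+ (suc n) _ _)

  binomialSum-*ˡ : ∀ a e (c : ℕ → ℤ) n → binomialSum a (λ k → e * c k) n ≡ e * binomialSum a c n
  binomialSum-*ˡ a e c n = trans (∑<-cong (suc n) (λ k → swap (+ (n C k) * a ^ k) e (c k))) (∑<-*ˡ (suc n) e _)
    where
    swap : ∀ x e y → x * (e * y) ≡ e * (x * y)
    swap = solve-∀

  binomial-theorem : ∀ a n → binomialSum a (λ _ → 1ℤ) n ≡ (a + 1ℤ) ^ n
  binomial-theorem a zero    = refl
  binomial-theorem a (suc n) = begin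
    binomialSum a (λ _ → 1ℤ) (suc n)                        ≡⟨ binomialSum-suc a _ n ⟩
    binomialSum a (λ _ → 1ℤ) n + a * binomialSum a (λ _ → 1ℤ) n     ≡⟨ cong (λ b → b + a * b) (binomial-theorem a n) ⟩
    (a + 1ℤ) ^ n + a * (a + 1ℤ) ^ n                         ≡⟨ factor a ((a + 1ℤ) ^ n) ⟩
    (a + 1ℤ) ^ suc n                                        ∎
    where
    factor : ∀ a y → y + a * y ≡ (a + 1ℤ) * y
    factor = solve-∀

  binomialSum-recurrence : ∀ a c → (∀ k → c k + c (suc k) + c (suc (suc k)) ≡ 0ℤ) → ∀ n →
    binomialSum a c (suc (suc n))
      ≡ (+ 2 - a) * binomialSum a c (suc n) - (a * a - a + 1ℤ) * binomialSum a c n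
  binomialSum-recurrence a c period n = begin
    binomialSum a c (suc (suc n))
      ≡⟨ binomialSum-suc a c (suc n) ⟩
    binomialSum a c (suc n) + a * binomialSum a (c ∘ suc) (suc n)
      ≡⟨ cong₂ (λ u w → u + a * w) (binomialSum-suc a c n) (binomialSum-suc a (c ∘ suc) n) ⟩
    X + a * Y + a * (Y + a * Z)
      ≡⟨ expand a X Y Z ⟩
    (+ 2 - a) * (X + a * Y) - (a * a - a + 1ℤ) * X + a * a * (X + Y + Z)
      ≡⟨ cong (λ s → (+ 2 - a) * (X + a * Y) - (a * a - a + 1ℤ) * X + a * a * s) X+Y+Z≡0 ⟩
    (+ 2 - a) * (X + a * Y) - (a * a - a + 1ℤ) * X + a * a * 0ℤ
      ≡⟨ drop-zero a ((+ 2 - a) * (X + a * Y) - (a * a - a + 1ℤ) * X) ⟩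
    (+ 2 - a) * (X + a * Y) - (a * a - a + 1ℤ) * X
      ≡⟨ cong (λ u → (+ 2 - a) * u - (a * a - a + 1ℤ) * X) (sym (binomialSum-suc a c n)) ⟩
    (+ 2 - a) * binomialSum a c (suc n) - (a * a - a + 1ℤ) * X ∎
    where
    X = binomialSum a c n
    Y = binomialSum a (c ∘ suc) n
    Z = binomialSum a (c ∘ suc ∘ suc) n
    X+Y+Z≡0 : X + Y + Z ≡ 0ℤ
    X+Y+Z≡0 = begin
      X + Y + Z                                                        ≡⟨ cong (λ s → s + Z) (sym (binomialSum-+ a c (c ∘ suc) n)) ⟩
      binomialSum a (λ k → c k + c (suc k)) n + Z                      ≡⟨ sym (binomialSum-+ a _ (c ∘ suc ∘ suc) n) ⟩
      binomialSum a (λ k → c k + c (suc k) + c (suc (suc k))) n        ≡⟨ binomialSum-cong a n period ⟩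
      binomialSum a (λ _ → 0ℤ * 0ℤ) n                                  ≡⟨ binomialSum-*ˡ a 0ℤ (λ _ → 0ℤ) n ⟩
      0ℤ * binomialSum a (λ _ → 0ℤ) n                                  ≡⟨ ℤP.*-zeroˡ (binomialSum a (λ _ → 0ℤ) n) ⟩
      0ℤ                                                               ∎
    expand : ∀ a X Y Z → X + a * Y + a * (Y + a * Z)
      ≡ (+ 2 - a) * (X + a * Y) - (a * a - a + 1ℤ) * X + a * a * (X + Y + Z)
    expand = solve-∀
    drop-zero : ∀ a s → s + a * a * 0ℤ ≡ s
    drop-zero = solve-∀

module ClosedForm where

  open import Data.Nat using (zero; suc; _<_; z≤n; s≤s)
  import Data.Nat.Properties as ℕP
  open import Data.Nat.Combinatorics using (_C_)
  open import Data.Nat.Tactic.RingSolver using () renaming (solve-∀ to solve-∀ℕ)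
  open import Data.Integer using (0ℤ; 1ℤ; _+_; _*_; _-_; -_; _^_)
  import Data.Integer.Properties as ℤP
  open import Data.Integer.Tactic.RingSolver using (solve-∀)
  open import Data.Product using (_×_; _,_; proj₁)
  open import Relation.Binary.PropositionalEquality using (refl; sym; trans; cong; cong₂; module ≡-Reasoning)
  open ≡-Reasoning
  open BinomialSums

  δ₃ : ℕ → ℤ
  δ₃ 0                     = 1ℤ
  δ₃ 1                     = 0ℤ
  δ₃ 2                     = 0ℤ
  δ₃ (suc (suc (suc k)))   = δ₃ k

  χ : ℕ → ℤ
  χ k = + 3 * δ₃ k - 1ℤ

  χ-period : ∀ k → χ k + χ (suc k) + χ (suc (suc k)) ≡ 0ℤ
  χ-period 0                   = refl
  χ-period 1                   = refl
  χ-period 2                   = refl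
  χ-period (suc (suc (suc k))) = χ-period k

  v≡binomialSum-χ : ∀ a n → v a n ≡ binomialSum a χ n
  v≡binomialSum-χ a n = proj₁ (consecutive n)
    where
    v₁ : + 2 - a ≡ binomialSum a χ 1
    v₁ = sym (trans (binomialSum-suc a χ 0) (lemma a))
      where
      lemma : ∀ a → + 2 + a * - 1ℤ ≡ + 2 - a
      lemma = solve-∀
    consecutive : ∀ n → v a n ≡ binomialSum a χ n × v a (suc n) ≡ binomialSum a χ (suc n)
    consecutive zero    = refl , v₁
    consecutive (suc n) with consecutive n
    ... | vₙ , vₙ₊₁ = vₙ₊₁ , trans (cong₂ (λ u w → (+ 2 - a) * u - (a * a - a + 1ℤ) * w) vₙ₊₁ vₙ)
                                   (sym (binomialSum-recurrence a χ χ-period n))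

  v≡3∑δ₃-[a+1]^n : ∀ a n → v a n ≡ + 3 * binomialSum a δ₃ n - (a + 1ℤ) ^ n
  v≡3∑δ₃-[a+1]^n a n = begin
    v a n                                                           ≡⟨ v≡binomialSum-χ a n ⟩
    binomialSum a χ n                                               ≡⟨ binomialSum-+ a (λ k → + 3 * δ₃ k) (λ _ → - 1ℤ) n ⟩
    binomialSum a (λ k → + 3 * δ₃ k) n + binomialSum a (λ _ → - 1ℤ * 1ℤ) n
      ≡⟨ cong₂ _+_ (binomialSum-*ˡ a (+ 3) δ₃ n) (binomialSum-*ˡ a (- 1ℤ) (λ _ → 1ℤ) n) ⟩
    + 3 * binomialSum a δ₃ n + - 1ℤ * binomialSum a (λ _ → 1ℤ) n    ≡⟨ cong (λ y → + 3 * binomialSum a δ₃ n + - 1ℤ * y) (binomial-theorem a n) ⟩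
    + 3 * binomialSum a δ₃ n + - 1ℤ * (a + 1ℤ) ^ n                  ≡⟨ negate (+ 3 * binomialSum a δ₃ n) ((a + 1ℤ) ^ n) ⟩
    + 3 * binomialSum a δ₃ n - (a + 1ℤ) ^ n                         ∎
    where
    negate : ∀ x y → x + - 1ℤ * y ≡ x - y
    negate = solve-∀

  δ₃-periodic : ∀ r m → δ₃ (r ℕ.+ m ℕ.* 3) ≡ δ₃ r
  δ₃-periodic r zero    = cong δ₃ (ℕP.+-identityʳ r)
  δ₃-periodic r (suc m) = trans (cong δ₃ (shift r (m ℕ.* 3))) (δ₃-periodic r m)
    where
    shift : ∀ r x → r ℕ.+ (3 ℕ.+ x) ≡ 3 ℕ.+ (r ℕ.+ x)
    shift = solve-∀ℕ

  ∑<-multiples-of-3 : ∀ (f : ℕ → ℤ) m → ∑< (m ℕ.* 3) (λ k → f k * δ₃ k) ≡ ∑< m (λ j → f (3 ℕ.* j))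
  ∑<-multiples-of-3 f zero    = refl
  ∑<-multiples-of-3 f (suc m) = begin
    ∑< M g + g M + g (1 ℕ.+ M) + g (2 ℕ.+ M)
      ≡⟨ cong₂ _+_ (cong₂ _+_ (cong₂ _+_ (∑<-multiples-of-3 f m) (periodic 0)) (periodic 1)) (periodic 2) ⟩
    ∑< m h + f M * 1ℤ + f (1 ℕ.+ M) * 0ℤ + f (2 ℕ.+ M) * 0ℤ
      ≡⟨ keep-first (∑< m h) (f M) (f (1 ℕ.+ M)) (f (2 ℕ.+ M)) ⟩
    ∑< m h + f M
      ≡⟨ cong (λ k → ∑< m h + f k) (ℕP.*-comm m 3) ⟩
    ∑< m h + f (3 ℕ.* m) ∎
    where
    M = m ℕ.* 3
    g h : ℕ → ℤ
    g k = f k * δ₃ k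
    h j = f (3 ℕ.* j)
    periodic : ∀ r → g (r ℕ.+ M) ≡ f (r ℕ.+ M) * δ₃ r
    periodic r = cong (λ d → f (r ℕ.+ M) * d) (δ₃-periodic r m)
    keep-first : ∀ s x y z → s + x * 1ℤ + y * 0ℤ + z * 0ℤ ≡ s + x
    keep-first = solve-∀

  drop-vanishing : ∀ {s t d} x → s ≡ t → d ≡ 0ℤ → s + x * d ≡ t
  drop-vanishing {t = t} x refl refl = trans (cong (_+_ t) (ℤP.*-zeroʳ x)) (ℤP.+-identityʳ t)

  ∑<-δ₃ : ∀ (f : ℕ → ℤ) m r → r < 3 →
    ∑< (suc (r ℕ.+ m ℕ.* 3)) (λ k → f k * δ₃ k) ≡ ∑< (suc m) (λ j → f (3 ℕ.* j))
  ∑<-δ₃ f m 0 _ = begin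
    ∑< (m ℕ.* 3) (λ k → f k * δ₃ k) + f (m ℕ.* 3) * δ₃ (m ℕ.* 3)
      ≡⟨ cong₂ _+_ (∑<-multiples-of-3 f m) (cong (λ d → f (m ℕ.* 3) * d) (δ₃-periodic 0 m)) ⟩
    ∑< m (λ j → f (3 ℕ.* j)) + f (m ℕ.* 3) * 1ℤ
      ≡⟨ cong (_+_ (∑< m (λ j → f (3 ℕ.* j)))) (trans (ℤP.*-identityʳ _) (cong f (ℕP.*-comm m 3))) ⟩
    ∑< m (λ j → f (3 ℕ.* j)) + f (3 ℕ.* m) ∎
  ∑<-δ₃ f m 1 _ = drop-vanishing (f (1 ℕ.+ m ℕ.* 3)) (∑<-δ₃ f m 0 (s≤s z≤n)) (δ₃-periodic 1 m)
  ∑<-δ₃ f m 2 _ = drop-vanishing (f (2 ℕ.+ m ℕ.* 3)) (∑<-δ₃ f m 1 (s≤s (s≤s z≤n))) (δ₃-periodic 2 m)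
  ∑<-δ₃ f m (suc (suc (suc _))) (s≤s (s≤s (s≤s ())))

  v-identity : ∀ a n m r → r < 3 → suc n ≡ r ℕ.+ m ℕ.* 3 →
    v a (suc n) - (+ 2 - a) + (a + 1ℤ) * ((a + 1ℤ) ^ n - 1ℤ)
      ≡ + 3 * ∑< m (λ j → + (suc n C (3 ℕ.* suc j)) * a ^ (3 ℕ.* suc j))
  v-identity a n m r r<3 n+1≡r+3m = begin
    v a (suc n) - (+ 2 - a) + (a + 1ℤ) * (Y - 1ℤ)
      ≡⟨ cong (λ x → x - (+ 2 - a) + (a + 1ℤ) * (Y - 1ℤ)) (v≡3∑δ₃-[a+1]^n a (suc n)) ⟩
    + 3 * binomialSum a δ₃ (suc n) - (a + 1ℤ) * Y - (+ 2 - a) + (a + 1ℤ) * (Y - 1ℤ)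
      ≡⟨ cong (λ s → + 3 * s - (a + 1ℤ) * Y - (+ 2 - a) + (a + 1ℤ) * (Y - 1ℤ)) multiples ⟩
    + 3 * (1ℤ + S) - (a + 1ℤ) * Y - (+ 2 - a) + (a + 1ℤ) * (Y - 1ℤ)
      ≡⟨ simplify a S Y ⟩
    + 3 * S ∎
    where
    Y = (a + 1ℤ) ^ n
    f : ℕ → ℤ
    f k = + (suc n C k) * a ^ k
    S = ∑< m (λ j → f (3 ℕ.* suc j))
    multiples : binomialSum a δ₃ (suc n) ≡ 1ℤ + S
    multiples = begin
      ∑< (suc (suc n)) (λ k → f k * δ₃ k)             ≡⟨ cong (λ N → ∑< (suc N) (λ k → f k * δ₃ k)) n+1≡r+3m ⟩
      ∑< (suc (r ℕ.+ m ℕ.* 3)) (λ k → f k * δ₃ k)     ≡⟨ ∑<-δ₃ f m r r<3 ⟩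
      ∑< (suc m) (λ j → f (3 ℕ.* j))                 ≡⟨ ∑<-suc m _ ⟩
      1ℤ + S                                         ∎
    simplify : ∀ a S Y → + 3 * (1ℤ + S) - (a + 1ℤ) * Y - (+ 2 - a) + (a + 1ℤ) * (Y - 1ℤ) ≡ + 3 * S
    simplify = solve-∀

module NegativePowers where

  open import Data.Nat using (zero; suc)
  open import Data.Integer using (1ℤ; _*_; -_; _^_)
  open import Data.Integer.Tactic.RingSolver using (solve-∀)
  open import Relation.Binary.PropositionalEquality using (refl; trans; cong)

  neg-^ : ∀ n x → (- x) ^ n ≡ (- 1ℤ) ^ n * x ^ n
  neg-^ zero    x = refl
  neg-^ (suc n) x = trans (cong (λ y → - x * y) (neg-^ n x)) (regroup x ((- 1ℤ) ^ n) (x ^ n))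
    where
    regroup : ∀ x s y → - x * (s * y) ≡ - 1ℤ * s * (x * y)
    regroup = solve-∀

  -1^odd : ∀ t → (- 1ℤ) ^ (1 ℕ.+ t ℕ.* 2) ≡ - 1ℤ
  -1^odd zero    = refl
  -1^odd (suc t) = cong (λ y → - 1ℤ * (- 1ℤ * y)) (-1^odd t)

module ModPrime (p′ : ℕ) (p-prime : Prime (ℕ.suc p′)) where

  open import Data.Nat using (zero; suc; _≤_; _<_; z≤n; s≤s)
  import Data.Nat.Properties as ℕP
  open import Data.Nat.Divisibility using (_∣_; divides; _∣0; >⇒∤)
  open import Data.Nat.Primality using (euclidsLemma; prime⇒irreducible)
  open import Data.Nat.Combinatorics using (_C_; nCn≡1; nCk+nC[k+1]≡[n+1]C[k+1])
  open import Data.Integer using (1ℤ; _+_; _*_; _-_; -_; _^_)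
  import Data.Integer.Properties as ℤP
  open import Data.Integer.Divisibility.Signed
    using (∣ᵤ⇒∣; ∣⇒∣ᵤ; ∣m∣n⇒∣m+n; ∣m⇒∣-m; ∣m∣n⇒∣m-n; ∣m⇒∣m*n) renaming (_∣_ to _∣ᵢ_)
  open import Data.Integer.Tactic.RingSolver using (solve-∀)
  open import Data.Sum using (inj₁; inj₂)
  open import Function using (_∘_)
  open import Relation.Binary.PropositionalEquality
    using (sym; trans; cong; cong₂; subst; module ≡-Reasoning)
  open ≡-Reasoning
  open BinomialSums
  open NegativePowers

  p : ℕ
  p = suc p′

  p∣pCk : ∀ {k} → 0 < k → k < p → p ∣ p C k
  p∣pCk {suc k} _ k<p with euclidsLemma (suc k) (p C suc k) p-prime
                             (divides (p′ C k) (trans (suc-*-C p′ k) (ℕP.*-comm p (p′ C k))))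
  ... | inj₁ p∣k+1 = ⊥-elim (>⇒∤ k<p p∣k+1)
  ... | inj₂ p∣pCk = p∣pCk

  ℕ∣⇒ℤ∣ : ∀ {n} → p ∣ n → + p ∣ᵢ + n
  ℕ∣⇒ℤ∣ = ∣ᵤ⇒∣

  p∣p′Ck-[-1]^k : ∀ {k} → k ≤ p′ → + p ∣ᵢ + (p′ C k) - (- 1ℤ) ^ k
  p∣p′Ck-[-1]^k {zero}  _     = ℕ∣⇒ℤ∣ (p ∣0)
  p∣p′Ck-[-1]^k {suc k} k<p′ = subst (+ p ∣ᵢ_) alternate
    (∣m∣n⇒∣m-n (ℕ∣⇒ℤ∣ (p∣pCk (s≤s z≤n) (s≤s k<p′))) (p∣p′Ck-[-1]^k (ℕP.<⇒≤ k<p′)))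
    where
    step : ∀ x y s → x + y - (x - s) ≡ y - - 1ℤ * s
    step = solve-∀
    alternate : + (p C suc k) - (+ (p′ C k) - (- 1ℤ) ^ k) ≡ + (p′ C suc k) - (- 1ℤ) ^ suc k
    alternate = begin
      + (p C suc k) - (+ (p′ C k) - (- 1ℤ) ^ k)
        ≡⟨ cong (λ m → + m - (+ (p′ C k) - (- 1ℤ) ^ k)) (sym (nCk+nC[k+1]≡[n+1]C[k+1] p′ k)) ⟩
      + (p′ C k) + + (p′ C suc k) - (+ (p′ C k) - (- 1ℤ) ^ k)
        ≡⟨ step (+ (p′ C k)) (+ (p′ C suc k)) ((- 1ℤ) ^ k) ⟩
      + (p′ C suc k) - (- 1ℤ) ^ suc k ∎

  freshmans-dream : ∀ a → + p ∣ᵢ (a + 1ℤ) ^ p - a ^ p - 1ℤ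
  freshmans-dream a = subst (+ p ∣ᵢ_) (sym (trans (cong (λ y → y - a ^ p - 1ℤ) expansion) (cancel M (a ^ p))))
    (∑<-∣ p′ (λ {k} k<p′ → ∣m⇒∣m*n 1ℤ (∣m⇒∣m*n (a ^ suc k) (ℕ∣⇒ℤ∣ (p∣pCk (s≤s z≤n) (s≤s k<p′))))))
    where
    F : ℕ → ℤ
    F k = + (p C k) * a ^ k * 1ℤ
    M = ∑< p′ (F ∘ suc)
    top : F p ≡ a ^ p
    top = begin
      + (p C p) * a ^ p * 1ℤ ≡⟨ cong (λ m → + m * a ^ p * 1ℤ) (nCn≡1 p) ⟩
      1ℤ * a ^ p * 1ℤ        ≡⟨ ℤP.*-identityʳ (1ℤ * a ^ p) ⟩
      1ℤ * a ^ p             ≡⟨ ℤP.*-identityˡ (a ^ p) ⟩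
      a ^ p                  ∎
    expansion : (a + 1ℤ) ^ p ≡ 1ℤ + M + a ^ p
    expansion = trans (sym (binomial-theorem a p)) (cong₂ _+_ (∑<-suc p′ F) top)
    cancel : ∀ M A → 1ℤ + M + A - A - 1ℤ ≡ M
    cancel = solve-∀

  fermat-ℕ : ∀ n → + p ∣ᵢ (+ n) ^ p - + n
  fermat-ℕ zero    = ℕ∣⇒ℤ∣ (p ∣0)
  fermat-ℕ (suc n) = subst (λ b → + p ∣ᵢ b ^ p - b) (cong +_ (ℕP.+-comm n 1))
    (subst (+ p ∣ᵢ_) (regroup (+ n) ((+ n) ^ p) ((+ n + 1ℤ) ^ p)) (∣m∣n⇒∣m+n (freshmans-dream (+ n)) (fermat-ℕ n)))
    where
    regroup : ∀ x X Y → Y - X - 1ℤ + (X - x) ≡ Y - (x + 1ℤ)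
    regroup = solve-∀

  fermat : (- 1ℤ) ^ p ≡ - 1ℤ → ∀ b → + p ∣ᵢ b ^ p - b
  fermat _   (+ n)    = fermat-ℕ n
  fermat odd -[1+ n ] = subst (+ p ∣ᵢ_) negate (∣m⇒∣-m (fermat-ℕ (suc n)))
    where
    c = + suc n
    flip : ∀ X c → - (X - c) ≡ - 1ℤ * X - - c
    flip = solve-∀
    negate : - (c ^ p - c) ≡ (- c) ^ p - - c
    negate = begin
      - (c ^ p - c)              ≡⟨ flip (c ^ p) c ⟩
      - 1ℤ * c ^ p - - c         ≡⟨ cong (λ s → s * c ^ p - - c) (sym odd) ⟩
      (- 1ℤ) ^ p * c ^ p - - c   ≡⟨ cong (λ y → y - - c) (sym (neg-^ p c)) ⟩
      (- c) ^ p - - c            ∎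

  euclid-ℤ : ∀ {x y} → + p ∣ᵢ x * y → ¬ (+ p ∣ℤ x) → + p ∣ᵢ y
  euclid-ℤ {x} {y} p∣xy p∤x with euclidsLemma ℤ.∣ x ∣ ℤ.∣ y ∣ p-prime (subst (p ∣_) (ℤP.abs-* x y) (∣⇒∣ᵤ p∣xy))
  ... | inj₁ p∣x = ⊥-elim (p∤x p∣x)
  ... | inj₂ p∣y = ∣ᵤ⇒∣ p∣y

  fermat-quotient : (- 1ℤ) ^ p ≡ - 1ℤ → ∀ b → ¬ (+ p ∣ℤ b) → + p ∣ᵢ b ^ p′ - 1ℤ
  fermat-quotient odd b = euclid-ℤ {b} (subst (+ p ∣ᵢ_) (factor b (b ^ p′)) (fermat odd b))
    where
    factor : ∀ b y → b * y - b ≡ b * (y - 1ℤ)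
    factor = solve-∀

  -1^p≡-1 : p ≢ 2 → (- 1ℤ) ^ p ≡ - 1ℤ
  -1^p≡-1 p≢2 with p % 2 | m%n<n p 2 | m≡m%n+[m/n]*n p 2
  ... | 0 | _ | p≡2t with prime⇒irreducible p-prime (divides (p / 2) p≡2t)
  ...   | inj₁ ()
  ...   | inj₂ 2≡p = ⊥-elim (p≢2 (sym 2≡p))
  -1^p≡-1 p≢2 | 1 | _ | p≡1+2t = trans (cong ((- 1ℤ) ^_) p≡1+2t) (-1^odd (p / 2))
  -1^p≡-1 p≢2 | suc (suc _) | s≤s (s≤s ()) | _

module Rationals where

  open import Data.Nat using (zero; suc; _≤_; z≤n; s≤s)
  import Data.Nat.Properties as ℕP
  import Data.Integer.Properties as ℤP
  open import Data.Rational using (1ℚ; mkℚ; _+_; _*_; _-_; -_; ↥_; ↧_; toℚᵘ; fromℚᵘ)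
  import Data.Rational.Properties as ℚP
  open import Data.Rational.Unnormalised as ℚᵘ using (ℚᵘ; mkℚᵘ; *≡*)
  import Data.Rational.Unnormalised.Properties as ℚᵘP
  open import Function using (_∘_)
  open import Relation.Binary.PropositionalEquality
    using (refl; sym; trans; cong; cong₂; module ≡-Reasoning)
  open import Data.Rational.Solver using (module +-*-Solver)
  open +-*-Solver using (solve; _:*_; _:=_)
  open BinomialSums using (∑<)

  module _ (u w : ℚᵘ) where
    open ℚᵘP.≃-Reasoning

    fromℚᵘ-homo-+ : fromℚᵘ (u ℚᵘ.+ w) ≡ fromℚᵘ u + fromℚᵘ w
    fromℚᵘ-homo-+ = ℚP.toℚᵘ-injective (begin
      toℚᵘ (fromℚᵘ (u ℚᵘ.+ w))              ≈⟨ ℚP.toℚᵘ-fromℚᵘ (u ℚᵘ.+ w) ⟩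
      u ℚᵘ.+ w                               ≈⟨ ℚᵘP.+-cong (ℚᵘP.≃-sym (ℚP.toℚᵘ-fromℚᵘ u)) (ℚᵘP.≃-sym (ℚP.toℚᵘ-fromℚᵘ w)) ⟩
      toℚᵘ (fromℚᵘ u) ℚᵘ.+ toℚᵘ (fromℚᵘ w)  ≈⟨ ℚᵘP.≃-sym (ℚP.toℚᵘ-homo-+ (fromℚᵘ u) (fromℚᵘ w)) ⟩
      toℚᵘ (fromℚᵘ u + fromℚᵘ w)            ∎)

    fromℚᵘ-homo-* : fromℚᵘ (u ℚᵘ.* w) ≡ fromℚᵘ u * fromℚᵘ w
    fromℚᵘ-homo-* = ℚP.toℚᵘ-injective (begin
      toℚᵘ (fromℚᵘ (u ℚᵘ.* w))              ≈⟨ ℚP.toℚᵘ-fromℚᵘ (u ℚᵘ.* w) ⟩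
      u ℚᵘ.* w                               ≈⟨ ℚᵘP.*-cong (ℚᵘP.≃-sym (ℚP.toℚᵘ-fromℚᵘ u)) (ℚᵘP.≃-sym (ℚP.toℚᵘ-fromℚᵘ w)) ⟩
      toℚᵘ (fromℚᵘ u) ℚᵘ.* toℚᵘ (fromℚᵘ w)  ≈⟨ ℚᵘP.≃-sym (ℚP.toℚᵘ-homo-* (fromℚᵘ u) (fromℚᵘ w)) ⟩
      toℚᵘ (fromℚᵘ u * fromℚᵘ w)            ∎)

  fromℚᵘ-homo‿- : ∀ u → fromℚᵘ (ℚᵘ.- u) ≡ - fromℚᵘ u
  fromℚᵘ-homo‿- u = ℚP.toℚᵘ-injective (begin
    toℚᵘ (fromℚᵘ (ℚᵘ.- u))       ≈⟨ ℚP.toℚᵘ-fromℚᵘ (ℚᵘ.- u) ⟩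
    ℚᵘ.- u                        ≈⟨ ℚᵘP.-‿cong (ℚᵘP.≃-sym (ℚP.toℚᵘ-fromℚᵘ u)) ⟩
    ℚᵘ.- toℚᵘ (fromℚᵘ u)          ≈⟨ ℚᵘP.≃-sym (ℚP.toℚᵘ-homo‿- (fromℚᵘ u)) ⟩
    toℚᵘ (- fromℚᵘ u)             ∎)
    where open ℚᵘP.≃-Reasoning

  -- ι x and + 1 ℚ./ suc n are definitionally fromℚᵘ (mkℚᵘ x 0) and fromℚᵘ (mkℚᵘ (+ 1) n).
  ι-+ : ∀ x y → ι (x ℤ.+ y) ≡ ι x + ι y
  ι-+ x y = trans (cong ι (sym (cong₂ ℤ._+_ (ℤP.*-identityʳ x) (ℤP.*-identityʳ y))))
                  (fromℚᵘ-homo-+ (mkℚᵘ x 0) (mkℚᵘ y 0))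

  ι-* : ∀ x y → ι (x ℤ.* y) ≡ ι x * ι y
  ι-* x y = fromℚᵘ-homo-* (mkℚᵘ x 0) (mkℚᵘ y 0)

  ι-neg : ∀ x → ι (ℤ.- x) ≡ - ι x
  ι-neg x = fromℚᵘ-homo‿- (mkℚᵘ x 0)

  ι-- : ∀ x y → ι (x ℤ.- y) ≡ ι x - ι y
  ι-- x y = trans (ι-+ x (ℤ.- y)) (cong (_+_ (ι x)) (ι-neg y))

  recip-*-ι : ∀ n → (+ 1 ℚ./ suc n) * ι (+ suc n) ≡ 1ℚ
  recip-*-ι n = trans (sym (fromℚᵘ-homo-* (mkℚᵘ (+ 1) n) (mkℚᵘ (+ suc n) 0)))
                      (ℚP.fromℚᵘ-cong {mkℚᵘ (+ 1 ℤ.* + suc n) (n ℕ.* 1)} {ℚᵘ.1ℚᵘ} (*≡* cross-multiplied))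
    where
    cross-multiplied : (+ 1 ℤ.* + suc n) ℤ.* + 1 ≡ + 1 ℤ.* + suc (n ℕ.* 1)
    cross-multiplied = begin
      (+ 1 ℤ.* + suc n) ℤ.* + 1  ≡⟨ ℤP.*-identityʳ (+ 1 ℤ.* + suc n) ⟩
      + 1 ℤ.* + suc n            ≡⟨ cong (λ m → + 1 ℤ.* + suc m) (sym (ℕP.*-identityʳ n)) ⟩
      + 1 ℤ.* + suc (n ℕ.* 1)    ∎
      where open ≡-Reasoning

  ÷ℕ-*-cancel : ∀ x n → (x ÷ℕ suc n) * ι (+ suc n) ≡ x
  ÷ℕ-*-cancel x n = begin
    x * (+ 1 ℚ./ suc n) * ι (+ suc n)     ≡⟨ ℚP.*-assoc x _ _ ⟩
    x * ((+ 1 ℚ./ suc n) * ι (+ suc n))   ≡⟨ cong (x *_) (recip-*-ι n) ⟩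
    x * 1ℚ                                ≡⟨ ℚP.*-identityʳ x ⟩
    x                                     ∎
    where open ≡-Reasoning

  *-÷ℕ-cancel : ∀ x n → (x * ι (+ suc n)) ÷ℕ suc n ≡ x
  *-÷ℕ-cancel x n = trans (swap x (ι (+ suc n)) (+ 1 ℚ./ suc n)) (÷ℕ-*-cancel x n)
    where
    swap : ∀ x d r → x * d * r ≡ x * r * d
    swap = solve 3 (λ x d r → x :* d :* r := x :* r :* d) refl

  *-ι-cancelʳ : ∀ {x y} n → x * ι (+ suc n) ≡ y * ι (+ suc n) → x ≡ y
  *-ι-cancelʳ {x} {y} n eq = trans (sym (*-÷ℕ-cancel x n)) (trans (cong (_÷ℕ suc n) eq) (*-÷ℕ-cancel y n))

  ÷ℕ-ι-* : ∀ x y n → (ι x ÷ℕ suc n) * ι y ≡ ι (x ℤ.* y) ÷ℕ suc n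
  ÷ℕ-ι-* x y n = trans (swap (ι x) (+ 1 ℚ./ suc n) (ι y)) (cong (_÷ℕ suc n) (sym (ι-* x y)))
    where
    swap : ∀ x r y → x * r * y ≡ x * y * r
    swap = solve 3 (λ x r y → x :* r :* y := x :* y :* r) refl

  neg-÷ℕ : ∀ x n → - (ι x ÷ℕ suc n) ≡ ι (ℤ.- x) ÷ℕ suc n
  neg-÷ℕ x n = trans (ℚP.neg-distribˡ-* (ι x) _) (cong (_÷ℕ suc n) (sym (ι-neg x)))

  *-ι≡ι⇒cross : ∀ x d N → x * ι (+ suc d) ≡ ι N → ↥ x ℤ.* + suc d ≡ N ℤ.* ↧ x
  *-ι≡ι⇒cross x@(mkℚ n e _) d N eq =
    trans (sym (ℤP.*-identityʳ (n ℤ.* + suc d)))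
          (trans (ℚᵘP.drop-*≡* similar) (cong (λ m → N ℤ.* + m) (ℕP.*-identityʳ (suc e))))
    where
    open ℚᵘP.≃-Reasoning
    similar : toℚᵘ x ℚᵘ.* mkℚᵘ (+ suc d) 0 ℚᵘ.≃ mkℚᵘ N 0
    similar = begin
      toℚᵘ x ℚᵘ.* mkℚᵘ (+ suc d) 0        ≈⟨ ℚᵘP.*-congˡ {toℚᵘ x} (ℚᵘP.≃-sym (ℚP.toℚᵘ-fromℚᵘ (mkℚᵘ (+ suc d) 0))) ⟩
      toℚᵘ x ℚᵘ.* toℚᵘ (ι (+ suc d))       ≈⟨ ℚᵘP.≃-sym (ℚP.toℚᵘ-homo-* x (ι (+ suc d))) ⟩
      toℚᵘ (x * ι (+ suc d))               ≡⟨ cong toℚᵘ eq ⟩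
      toℚᵘ (ι N)                           ≈⟨ ℚP.toℚᵘ-fromℚᵘ (mkℚᵘ N 0) ⟩
      mkℚᵘ N 0                             ∎

  ι-∑< : ∀ m (f : ℕ → ℤ) → ι (∑< m (f ∘ suc)) ≡ Σ₁ m (ι ∘ f)
  ι-∑< zero    f = refl
  ι-∑< (suc m) f = trans (ι-+ (∑< m (f ∘ suc)) (f (suc m))) (cong (_+ ι (f (suc m))) (ι-∑< m f))

  Σ₁-cong : ∀ m {f g : ℕ → ℚ} → (∀ {j} → 1 ≤ j → j ≤ m → f j ≡ g j) → Σ₁ m f ≡ Σ₁ m g
  Σ₁-cong zero    _   = refl
  Σ₁-cong (suc m) f≡g = cong₂ _+_ (Σ₁-cong m (λ 1≤j j≤m → f≡g 1≤j (ℕP.m≤n⇒m≤1+n j≤m))) (f≡g (s≤s z≤n) ℕP.≤-refl)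

  Σ₁-*ʳ : ∀ m (f : ℕ → ℚ) c → Σ₁ m f * c ≡ Σ₁ m (λ j → f j * c)
  Σ₁-*ʳ zero    f c = ℚP.*-zeroˡ c
  Σ₁-*ʳ (suc m) f c = trans (ℚP.*-distribʳ-+ c (Σ₁ m f) (f (suc m))) (cong (_+ f (suc m) * c) (Σ₁-*ʳ m f c))

  neg-Σ₁ : ∀ m (f : ℕ → ℚ) → - Σ₁ m f ≡ Σ₁ m (λ j → - f j)
  neg-Σ₁ zero    f = refl
  neg-Σ₁ (suc m) f = trans (ℚP.neg-distrib-+ (Σ₁ m f) (f (suc m))) (cong (_+ - f (suc m)) (neg-Σ₁ m f))

module Localisation (p : ℕ) (p-prime : Prime p) where

  open import Data.Nat using (zero; suc; _≤_; z≤n; s≤s)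
  import Data.Nat.Properties as ℕP
  open import Data.Nat.Divisibility using (_∣_; divides; ∣1⇒≡1; ∣-trans)
  import Data.Nat.Coprimality as Coprime
  open import Data.Nat.Primality using (euclidsLemma; ¬prime[1])
  open import Data.Nat.Tactic.RingSolver using () renaming (solve-∀ to solve-∀ℕ)
  import Data.Integer.Properties as ℤP
  open import Data.Integer.Divisibility.Signed using (divides) renaming (_∣_ to _∣ᵢ_)
  open import Data.Rational using (0ℚ; mkℚ; _+_; _*_; _-_; -_; ↥_; ↧_; ↧ₙ_)
  import Data.Rational.Properties as ℚP
  open import Data.Product using (_,_)
  open import Data.Sum using (inj₁; inj₂)
  open import Data.Empty using (⊥-elim)
  open import Relation.Binary.PropositionalEquality
    using (refl; sym; trans; cong; cong₂; subst; module ≡-Reasoning)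
  open ≡-Reasoning
  open import Data.Rational.Solver using (module +-*-Solver)
  open +-*-Solver using (solve; _:+_; _:*_; _:-_; _:=_)
  open Rationals

  p∤1 : ¬ p ∣ 1
  p∤1 p∣1 = ¬prime[1] (subst Prime (∣1⇒≡1 p∣1) p-prime)

  p∤-* : ∀ {m n} → ¬ p ∣ m → ¬ p ∣ n → ¬ p ∣ m ℕ.* n
  p∤-* {m} {n} p∤m p∤n p∣mn with euclidsLemma m n p-prime p∣mn
  ... | inj₁ p∣m = p∤m p∣m
  ... | inj₂ p∣n = p∤n p∣n

  -- A fraction for x, not necessarily reduced, whose denominator is prime to p.
  record _∈ℤ₍ₚ₎ (x : ℚ) : Set where
    constructor fraction
    field
      numerator     : ℤ
      denominator-1 : ℕ
      p∤denominator : ¬ p ∣ suc denominator-1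
      cleared       : x * ι (+ suc denominator-1) ≡ ι numerator

  ι∈ℤ₍ₚ₎ : ∀ N → ι N ∈ℤ₍ₚ₎
  ι∈ℤ₍ₚ₎ N = fraction N 0 p∤1 (ℚP.*-identityʳ (ι N))

  ι-suc-* : ∀ d e → ι (+ (suc d ℕ.* suc e)) ≡ ι (+ suc d) * ι (+ suc e)
  ι-suc-* d e = trans (cong ι (ℤP.pos-* (suc d) (suc e))) (ι-* (+ suc d) (+ suc e))

  +-∈ℤ₍ₚ₎ : ∀ {x y} → x ∈ℤ₍ₚ₎ → y ∈ℤ₍ₚ₎ → (x + y) ∈ℤ₍ₚ₎
  +-∈ℤ₍ₚ₎ {x} {y} (fraction M d p∤D xD≡M) (fraction N e p∤E yE≡N) =
    fraction (M ℤ.* + suc e ℤ.+ N ℤ.* + suc d) (e ℕ.+ d ℕ.* suc e) (p∤-* p∤D p∤E) (begin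
      (x + y) * ι (+ (suc d ℕ.* suc e))        ≡⟨ cong (λ z → (x + y) * z) (ι-suc-* d e) ⟩
      (x + y) * (D * E)                        ≡⟨ split x y D E ⟩
      x * D * E + y * E * D                    ≡⟨ cong₂ (λ u w → u * E + w * D) xD≡M yE≡N ⟩
      ι M * E + ι N * D                        ≡⟨ sym (cong₂ _+_ (ι-* M (+ suc e)) (ι-* N (+ suc d))) ⟩
      ι (M ℤ.* + suc e) + ι (N ℤ.* + suc d)    ≡⟨ sym (ι-+ (M ℤ.* + suc e) (N ℤ.* + suc d)) ⟩
      ι (M ℤ.* + suc e ℤ.+ N ℤ.* + suc d)      ∎)
    where
    D = ι (+ suc d)
    E = ι (+ suc e)
    split : ∀ x y D E → (x + y) * (D * E) ≡ x * D * E + y * E * D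
    split = solve 4 (λ x y D E → (x :+ y) :* (D :* E) := x :* D :* E :+ y :* E :* D) refl

  *-∈ℤ₍ₚ₎ : ∀ {x y} → x ∈ℤ₍ₚ₎ → y ∈ℤ₍ₚ₎ → (x * y) ∈ℤ₍ₚ₎
  *-∈ℤ₍ₚ₎ {x} {y} (fraction M d p∤D xD≡M) (fraction N e p∤E yE≡N) =
    fraction (M ℤ.* N) (e ℕ.+ d ℕ.* suc e) (p∤-* p∤D p∤E) (begin
      (x * y) * ι (+ (suc d ℕ.* suc e))        ≡⟨ cong (λ z → (x * y) * z) (ι-suc-* d e) ⟩
      (x * y) * (D * E)                        ≡⟨ ℚP.*-assoc x y (D * E) ⟩
      x * (y * (D * E))                        ≡⟨ regroup x y D E ⟩
      x * D * (y * E)                          ≡⟨ cong₂ _*_ xD≡M yE≡N ⟩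
      ι M * ι N                                ≡⟨ sym (ι-* M N) ⟩
      ι (M ℤ.* N)                              ∎)
    where
    D = ι (+ suc d)
    E = ι (+ suc e)
    regroup : ∀ x y D E → x * (y * (D * E)) ≡ x * D * (y * E)
    regroup = solve 4 (λ x y D E → x :* (y :* (D :* E)) := x :* D :* (y :* E)) refl

  ÷ℕ-∈ℤ₍ₚ₎ : ∀ {x} n → x ∈ℤ₍ₚ₎ → ¬ p ∣ suc n → (x ÷ℕ suc n) ∈ℤ₍ₚ₎
  ÷ℕ-∈ℤ₍ₚ₎ n x∈ p∤n+1 = *-∈ℤ₍ₚ₎ x∈ (fraction (+ 1) n p∤n+1 (recip-*-ι n))

  neg-∈ℤ₍ₚ₎ : ∀ {x} → x ∈ℤ₍ₚ₎ → (- x) ∈ℤ₍ₚ₎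
  neg-∈ℤ₍ₚ₎ {x} (fraction M d p∤D xD≡M) = fraction (ℤ.- M) d p∤D (begin
    - x * ι (+ suc d)     ≡⟨ sym (ℚP.neg-distribˡ-* x (ι (+ suc d))) ⟩
    - (x * ι (+ suc d))   ≡⟨ cong -_ xD≡M ⟩
    - ι M                 ≡⟨ sym (ι-neg M) ⟩
    ι (ℤ.- M)             ∎)

  Σ₁-∈ℤ₍ₚ₎ : ∀ m {f} → (∀ {j} → 1 ≤ j → j ≤ m → f j ∈ℤ₍ₚ₎) → Σ₁ m f ∈ℤ₍ₚ₎
  Σ₁-∈ℤ₍ₚ₎ zero    _  = ι∈ℤ₍ₚ₎ (+ 0)
  Σ₁-∈ℤ₍ₚ₎ (suc m) f∈ = +-∈ℤ₍ₚ₎ (Σ₁-∈ℤ₍ₚ₎ m (λ 1≤j j≤m → f∈ 1≤j (ℕP.m≤n⇒m≤1+n j≤m))) (f∈ (s≤s z≤n) ℕP.≤-refl)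

  ∈ℤ₍ₚ₎⇒pIntegral : ∀ {x} → x ∈ℤ₍ₚ₎ → pIntegral p x
  ∈ℤ₍ₚ₎⇒pIntegral {x@(mkℚ n e coprime)} (fraction N d p∤D xD≡N) p∣↧x = p∤D (∣-trans p∣↧x ↧x∣D)
    where
    ↧x∣D : suc e ∣ suc d
    ↧x∣D = Coprime.coprime-divisor (Coprime.sym (Coprime.recompute coprime)) (divides ℤ.∣ N ∣ (begin
      ℤ.∣ n ∣ ℕ.* suc d       ≡⟨ sym (ℤP.abs-* n (+ suc d)) ⟩
      ℤ.∣ n ℤ.* + suc d ∣     ≡⟨ cong ℤ.∣_∣ (*-ι≡ι⇒cross x d N xD≡N) ⟩
      ℤ.∣ N ℤ.* + suc e ∣     ≡⟨ ℤP.abs-* N (+ suc e) ⟩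
      ℤ.∣ N ∣ ℕ.* suc e       ∎))

  infix 4 _≈_

  record _≈_ (x y : ℚ) : Set where
    constructor congruent
    field
      quotient    : ℚ
      quotient∈   : quotient ∈ℤ₍ₚ₎
      difference  : x - y ≡ ι (+ p) * quotient

  ≈-refl : ∀ x → x ≈ x
  ≈-refl x = congruent 0ℚ (ι∈ℤ₍ₚ₎ (+ 0)) (trans (ℚP.+-inverseʳ x) (sym (ℚP.*-zeroʳ (ι (+ p)))))

  ≈-+ : ∀ {x y u w} → x ≈ y → u ≈ w → x + u ≈ y + w
  ≈-+ {x} {y} {u} {w} (congruent a a∈ x-y≡pa) (congruent b b∈ u-w≡pb) = congruent (a + b) (+-∈ℤ₍ₚ₎ a∈ b∈) (begin
    x + u - (y + w)                ≡⟨ interchange x u y w ⟩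
    (x - y) + (u - w)              ≡⟨ cong₂ _+_ x-y≡pa u-w≡pb ⟩
    ι (+ p) * a + ι (+ p) * b      ≡⟨ sym (ℚP.*-distribˡ-+ (ι (+ p)) a b) ⟩
    ι (+ p) * (a + b)              ∎)
    where
    interchange : ∀ x u y w → x + u - (y + w) ≡ (x - y) + (u - w)
    interchange = solve 4 (λ x u y w → x :+ u :- (y :+ w) := (x :- y) :+ (u :- w)) refl

  ≈-÷ℕ : ∀ {x y} n → ¬ p ∣ suc n → x ≈ y → x ÷ℕ suc n ≈ y ÷ℕ suc n
  ≈-÷ℕ {x} {y} n p∤n+1 (congruent a a∈ x-y≡pa) = congruent (a ÷ℕ suc n) (÷ℕ-∈ℤ₍ₚ₎ n a∈ p∤n+1) (begin
    x * r - y * r          ≡⟨ factor x y r ⟩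
    (x - y) * r            ≡⟨ cong (_* r) x-y≡pa ⟩
    ι (+ p) * a * r        ≡⟨ ℚP.*-assoc (ι (+ p)) a r ⟩
    ι (+ p) * (a * r)      ∎)
    where
    r = + 1 ℚ./ suc n
    factor : ∀ x y r → x * r - y * r ≡ (x - y) * r
    factor = solve 3 (λ x y r → x :* r :- y :* r := (x :- y) :* r) refl

  ∣⇒ι≈ : ∀ {x y} → + p ∣ᵢ x ℤ.- y → ι x ≈ ι y
  ∣⇒ι≈ {x} {y} (divides q x-y≡qp) = congruent (ι q) (ι∈ℤ₍ₚ₎ q) (begin
    ι x - ι y               ≡⟨ sym (ι-- x y) ⟩
    ι (x ℤ.- y)             ≡⟨ cong ι x-y≡qp ⟩
    ι (q ℤ.* + p)           ≡⟨ ι-* q (+ p) ⟩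
    ι q * ι (+ p)           ≡⟨ ℚP.*-comm (ι q) (ι (+ p)) ⟩
    ι (+ p) * ι q           ∎)

  Σ₁-≈ : ∀ m {f g} → (∀ {j} → 1 ≤ j → j ≤ m → f j ≈ g j) → Σ₁ m f ≈ Σ₁ m g
  Σ₁-≈ zero    _   = ≈-refl 0ℚ
  Σ₁-≈ (suc m) f≈g = ≈-+ (Σ₁-≈ m (λ 1≤j j≤m → f≈g 1≤j (ℕP.m≤n⇒m≤1+n j≤m))) (f≈g (s≤s z≤n) ℕP.≤-refl)

  ≈⇒≡[mod] : ∀ {x y} → y ∈ℤ₍ₚ₎ → x ≈ y → x ≡ y [mod p ]
  ≈⇒≡[mod] {x} {y} y∈ (congruent a a∈@(fraction N d p∤D aD≡N) x-y≡pa) =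
    ∈ℤ₍ₚ₎⇒pIntegral x∈ , ∈ℤ₍ₚ₎⇒pIntegral y∈ , p∣↥[x-y]
    where
    recombine : ∀ x y → y + (x - y) ≡ x
    recombine = solve 2 (λ x y → y :+ (x :- y) := x) refl
    x∈ : x ∈ℤ₍ₚ₎
    x∈ = subst _∈ℤ₍ₚ₎ (trans (cong (_+_ y) (sym x-y≡pa)) (recombine x y)) (+-∈ℤ₍ₚ₎ y∈ (*-∈ℤ₍ₚ₎ (ι∈ℤ₍ₚ₎ (+ p)) a∈))
    u = x - y
    uD≡pN : u * ι (+ suc d) ≡ ι (+ p ℤ.* N)
    uD≡pN = begin
      u * ι (+ suc d)               ≡⟨ cong (_* ι (+ suc d)) x-y≡pa ⟩
      ι (+ p) * a * ι (+ suc d)     ≡⟨ ℚP.*-assoc (ι (+ p)) a (ι (+ suc d)) ⟩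
      ι (+ p) * (a * ι (+ suc d))   ≡⟨ cong (ι (+ p) *_) aD≡N ⟩
      ι (+ p) * ι N                 ≡⟨ sym (ι-* (+ p) N) ⟩
      ι (+ p ℤ.* N)                 ∎
    rearrange : ∀ p n k → p ℕ.* n ℕ.* k ≡ n ℕ.* k ℕ.* p
    rearrange = solve-∀ℕ
    p∣↥u*D : p ∣ ℤ.∣ ↥ u ∣ ℕ.* suc d
    p∣↥u*D = divides (ℤ.∣ N ∣ ℕ.* ↧ₙ u) (begin
      ℤ.∣ ↥ u ∣ ℕ.* suc d                 ≡⟨ sym (ℤP.abs-* (↥ u) (+ suc d)) ⟩
      ℤ.∣ ↥ u ℤ.* + suc d ∣               ≡⟨ cong ℤ.∣_∣ (*-ι≡ι⇒cross u d (+ p ℤ.* N) uD≡pN) ⟩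
      ℤ.∣ + p ℤ.* N ℤ.* ↧ u ∣             ≡⟨ ℤP.abs-* (+ p ℤ.* N) (↧ u) ⟩
      ℤ.∣ + p ℤ.* N ∣ ℕ.* ↧ₙ u            ≡⟨ cong (ℕ._* ↧ₙ u) (ℤP.abs-* (+ p) N) ⟩
      p ℕ.* ℤ.∣ N ∣ ℕ.* ↧ₙ u              ≡⟨ rearrange p ℤ.∣ N ∣ (↧ₙ u) ⟩
      ℤ.∣ N ∣ ℕ.* ↧ₙ u ℕ.* p              ∎)
    p∣↥[x-y] : + p ∣ℤ ↥ u
    p∣↥[x-y] with euclidsLemma ℤ.∣ ↥ u ∣ (suc d) p-prime p∣↥u*D
    ... | inj₁ p∣↥u = p∣↥u
    ... | inj₂ p∣D  = ⊥-elim (p∤D p∣D)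

module Main (a : ℤ) (p′ : ℕ) (p-prime : Prime (ℕ.suc p′))
            (m r : ℕ) (r<3 : r ℕ.< 3) (p≡r+3m : ℕ.suc p′ ≡ r ℕ.+ m ℕ.* 3) where

  open import Data.Nat using (suc; pred; _≤_; z≤n; s≤s)
  import Data.Nat.Properties as ℕP
  open import Data.Nat.Divisibility using (_∣_; >⇒∤)
  open import Data.Nat.Combinatorics using (_C_)
  open import Data.Integer using (1ℤ; _+_; _*_; _-_; -_; _^_)
  import Data.Integer.Properties as ℤP
  open import Data.Integer.Divisibility.Signed using (divides; ∣m⇒∣m*n) renaming (_∣_ to _∣ᵢ_)
  open import Data.Integer.Tactic.RingSolver using (solve-∀)
  open import Function using (_∘_)
  open import Relation.Binary.PropositionalEquality
    using (refl; sym; trans; cong; cong₂; subst; subst₂; module ≡-Reasoning)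
  open BinomialSums
  open ClosedForm
  open NegativePowers
  open ModPrime p′ p-prime
  open Localisation p p-prime
  open Rationals
    using (ι-+; ι-*; ι-∑<; ÷ℕ-*-cancel; *-÷ℕ-cancel; *-ι-cancelʳ; ÷ℕ-ι-*; neg-÷ℕ; Σ₁-cong; Σ₁-*ʳ; neg-Σ₁)
  open import Data.Rational.Solver using (module +-*-Solver)
  open +-*-Solver using (solve; _:+_; _:*_; _:-_; _:=_)

  3j≤p : ∀ {j} → j ≤ m → 3 ℕ.* j ≤ p
  3j≤p {j} j≤m = begin
    3 ℕ.* j          ≤⟨ ℕP.*-monoʳ-≤ 3 j≤m ⟩
    3 ℕ.* m          ≡⟨ ℕP.*-comm 3 m ⟩
    m ℕ.* 3          ≤⟨ ℕP.m≤n+m (m ℕ.* 3) r ⟩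
    r ℕ.+ m ℕ.* 3    ≡⟨ sym p≡r+3m ⟩
    p                ∎
    where open ℕP.≤-Reasoning

  p∤j : ∀ {j} → 1 ≤ j → j ≤ m → ¬ p ∣ j
  p∤j {suc i} _ j≤m = >⇒∤ (begin-strict
    suc i            <⟨ ℕP.m<m*n (suc i) 3 (s≤s (s≤s z≤n)) ⟩
    suc i ℕ.* 3      ≡⟨ ℕP.*-comm (suc i) 3 ⟩
    3 ℕ.* suc i      ≤⟨ 3j≤p j≤m ⟩
    p                ∎)
    where open ℕP.≤-Reasoning

  h A : ℕ → ℤ
  h j = + (p C (3 ℕ.* j)) * a ^ (3 ℕ.* j)
  A j = + (p′ C pred (3 ℕ.* j)) * a ^ (3 ℕ.* j)

  t s : ℕ → ℚ
  t j = ι (A j) ÷ℕ j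
  s j = ι ((- a) ^ (3 ℕ.* j)) ÷ℕ j

  A*p≡3h*j : ∀ i → A (suc i) * + p ≡ + 3 * h (suc i) * + suc i
  A*p≡3h*j i = begin
    + (p′ C k) * y * + p                    ≡⟨ swap (+ (p′ C k)) y (+ p) ⟩
    + p * + (p′ C k) * y                    ≡⟨ cong (_* y) (sym (ℤP.pos-* p (p′ C k))) ⟩
    + (p ℕ.* (p′ C k)) * y                  ≡⟨ cong (λ n → + n * y) (sym (suc-*-C p′ k)) ⟩
    + (3 ℕ.* suc i ℕ.* c) * y               ≡⟨ cong (_* y) (ℤP.pos-* (3 ℕ.* suc i) c) ⟩
    + (3 ℕ.* suc i) * + c * y               ≡⟨ cong (λ z → z * + c * y) (ℤP.pos-* 3 (suc i)) ⟩
    + 3 * + suc i * + c * y                 ≡⟨ regroup (+ 3) (+ suc i) (+ c) y ⟩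
    + 3 * (+ c * y) * + suc i               ∎
    where
    open ≡-Reasoning
    k = pred (3 ℕ.* suc i)
    c = p C (3 ℕ.* suc i)
    y = a ^ (3 ℕ.* suc i)
    swap : ∀ c y p → c * y * p ≡ p * c * y
    swap = solve-∀
    regroup : ∀ t j c y → t * j * c * y ≡ t * (c * y) * j
    regroup = solve-∀

  t*p≡ι3h : ∀ {j} → 1 ≤ j → j ≤ m → t j ℚ.* ι (+ p) ≡ ι (+ 3 * h j)
  t*p≡ι3h {suc i} _ _ = begin
    (ι (A (suc i)) ÷ℕ suc i) ℚ.* ι (+ p)             ≡⟨ ÷ℕ-ι-* (A (suc i)) (+ p) i ⟩
    ι (A (suc i) * + p) ÷ℕ suc i                     ≡⟨ cong (λ z → ι z ÷ℕ suc i) (A*p≡3h*j i) ⟩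
    ι (+ 3 * h (suc i) * + suc i) ÷ℕ suc i           ≡⟨ cong (_÷ℕ suc i) (ι-* (+ 3 * h (suc i)) (+ suc i)) ⟩
    (ι (+ 3 * h (suc i)) ℚ.* ι (+ suc i)) ÷ℕ suc i   ≡⟨ *-÷ℕ-cancel (ι (+ 3 * h (suc i))) i ⟩
    ι (+ 3 * h (suc i))                              ∎
    where open ≡-Reasoning

  X Q W : ℚ
  X = ι (v a p - (+ 2 - a)) ÷ℕ p
  Q = q p (a + 1ℤ)
  W = ι (a + 1ℤ) ℚ.* Q

  X+W≡Σt : X ℚ.+ W ≡ Σ₁ m t
  X+W≡Σt = *-ι-cancelʳ p′ (begin
    (X ℚ.+ ι (a + 1ℤ) ℚ.* Q) ℚ.* P                    ≡⟨ distribute X (ι (a + 1ℤ)) Q P ⟩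
    X ℚ.* P ℚ.+ ι (a + 1ℤ) ℚ.* (Q ℚ.* P)              ≡⟨ cong₂ (λ x y → x ℚ.+ ι (a + 1ℤ) ℚ.* y) (÷ℕ-*-cancel (ι z) p′) (÷ℕ-*-cancel (ι F) p′) ⟩
    ι z ℚ.+ ι (a + 1ℤ) ℚ.* ι F                        ≡⟨ sym (trans (ι-+ z _) (cong (λ y → ι z ℚ.+ y) (ι-* (a + 1ℤ) F))) ⟩
    ι (z + (a + 1ℤ) * F)                              ≡⟨ cong ι (v-identity a p′ m r r<3 p≡r+3m) ⟩
    ι (+ 3 * ∑< m (h ∘ suc))                          ≡⟨ cong ι (sym (∑<-*ˡ m (+ 3) (h ∘ suc))) ⟩
    ι (∑< m (λ i → + 3 * h (suc i)))                  ≡⟨ ι-∑< m (λ j → + 3 * h j) ⟩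
    Σ₁ m (λ j → ι (+ 3 * h j))                        ≡⟨ sym (Σ₁-cong m t*p≡ι3h) ⟩
    Σ₁ m (λ j → t j ℚ.* P)                            ≡⟨ sym (Σ₁-*ʳ m t P) ⟩
    Σ₁ m t ℚ.* P                                      ∎)
    where
    open ≡-Reasoning
    P = ι (+ p)
    z = v a p - (+ 2 - a)
    F = (a + 1ℤ) ^ p′ - 1ℤ
    distribute : ∀ x c q P → (x ℚ.+ c ℚ.* q) ℚ.* P ≡ x ℚ.* P ℚ.+ c ℚ.* (q ℚ.* P)
    distribute = solve 4 (λ x c q P → (x :+ c :* q) :* P := x :* P :+ c :* (q :* P)) refl

  t≈-s : ∀ {j} → 1 ≤ j → j ≤ m → t j ≈ ℚ.- s j
  t≈-s {suc i} 1≤j j≤m = subst (t (suc i) ≈_) (sym (neg-÷ℕ B i)) (≈-÷ℕ i (p∤j 1≤j j≤m) (∣⇒ι≈ {A (suc i)} { - B} p∣A+B))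
    where
    open ≡-Reasoning
    k = pred (3 ℕ.* suc i)
    y = a ^ (3 ℕ.* suc i)
    B = (- a) ^ (3 ℕ.* suc i)
    alternate : ∀ c s y → c * y - - (- 1ℤ * s * y) ≡ (c - s) * y
    alternate = solve-∀
    A+B≡ : A (suc i) - - B ≡ (+ (p′ C k) - (- 1ℤ) ^ k) * y
    A+B≡ = begin
      + (p′ C k) * y - - B                          ≡⟨ cong (λ b → + (p′ C k) * y - - b) (neg-^ (suc k) a) ⟩
      + (p′ C k) * y - - ((- 1ℤ) ^ suc k * y)       ≡⟨ alternate (+ (p′ C k)) ((- 1ℤ) ^ k) y ⟩
      (+ (p′ C k) - (- 1ℤ) ^ k) * y                 ∎
    p∣A+B : + p ∣ᵢ A (suc i) - - B
    p∣A+B = subst (+ p ∣ᵢ_) (sym A+B≡) (∣m⇒∣m*n y (p∣p′Ck-[-1]^k (ℕP.≤-pred (3j≤p j≤m))))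

  Q∈ℤ₍ₚ₎ : (- 1ℤ) ^ p ≡ - 1ℤ → ¬ (+ p ∣ℤ (a + 1ℤ)) → Q ∈ℤ₍ₚ₎
  Q∈ℤ₍ₚ₎ odd p∤a+1 with fermat-quotient odd (a + 1ℤ) p∤a+1
  ... | divides n F≡np = subst _∈ℤ₍ₚ₎ (sym Q≡ιn) (ι∈ℤ₍ₚ₎ n)
    where
    open ≡-Reasoning
    Q≡ιn : Q ≡ ι n
    Q≡ιn = begin
      ι ((a + 1ℤ) ^ p′ - 1ℤ) ÷ℕ p      ≡⟨ cong (λ z → ι z ÷ℕ p) F≡np ⟩
      ι (n * + p) ÷ℕ p                 ≡⟨ cong (_÷ℕ p) (ι-* n (+ p)) ⟩
      (ι n ℚ.* ι (+ p)) ÷ℕ p           ≡⟨ *-÷ℕ-cancel (ι n) p′ ⟩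
      ι n                              ∎

  congruence : (- 1ℤ) ^ p ≡ - 1ℤ → ¬ (+ p ∣ℤ (a + 1ℤ)) →
    X ≡ ℚ.- Σ₁ m s ℚ.- ι (a + 1ℤ) ℚ.* Q [mod p ]
  congruence odd p∤a+1 = ≈⇒≡[mod] Y∈ℤ₍ₚ₎ (subst₂ _≈_ Σt-W≡X Σ-s-W≡Y (≈-+ (Σ₁-≈ m t≈-s) (≈-refl (ℚ.- W))))
    where
    cancel : ∀ x w → x ℚ.+ w ℚ.- w ≡ x
    cancel = solve 2 (λ x w → x :+ w :- w := x) refl
    Σt-W≡X : Σ₁ m t ℚ.- W ≡ X
    Σt-W≡X = trans (cong (λ T → T ℚ.- W) (sym X+W≡Σt)) (cancel X W)
    Σ-s-W≡Y : Σ₁ m (λ j → ℚ.- s j) ℚ.- W ≡ ℚ.- Σ₁ m s ℚ.- W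
    Σ-s-W≡Y = cong (λ S → S ℚ.- W) (sym (neg-Σ₁ m s))
    s∈ℤ₍ₚ₎ : ∀ {j} → 1 ≤ j → j ≤ m → s j ∈ℤ₍ₚ₎
    s∈ℤ₍ₚ₎ {suc i} 1≤j j≤m = ÷ℕ-∈ℤ₍ₚ₎ i (ι∈ℤ₍ₚ₎ ((- a) ^ (3 ℕ.* suc i))) (p∤j 1≤j j≤m)
    Y∈ℤ₍ₚ₎ : (ℚ.- Σ₁ m s ℚ.- W) ∈ℤ₍ₚ₎
    Y∈ℤ₍ₚ₎ = +-∈ℤ₍ₚ₎ (neg-∈ℤ₍ₚ₎ (Σ₁-∈ℤ₍ₚ₎ m s∈ℤ₍ₚ₎)) (neg-∈ℤ₍ₚ₎ (*-∈ℤ₍ₚ₎ (ι∈ℤ₍ₚ₎ (a + 1ℤ)) (Q∈ℤ₍ₚ₎ odd p∤a+1)))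

lemma4p9 : (a : ℤ) (p : ℕ) →
    a ≢ + 0 → a ≢ + 1 → a ≢ -[1+ 0 ] →
    Prime p → p ≢ 2 →
    ¬ ((+ p) ∣ℤ (+ 3 ℤ.* a ℤ.* (+ 2 ℤ.- a) ℤ.* (a ℤ.* a ℤ.- a ℤ.+ + 1))) →
    ¬ ((+ p) ∣ℤ (a ℤ.+ + 1)) →
    (ι (v a p ℤ.- (+ 2 ℤ.- a)) ÷ℕ p)
      ≡ ℚ.- Σ₁ (p / 3) (λ k → ι ((ℤ.- a) ℤ.^ (3 ℕ.* k)) ÷ℕ k)
        ℚ.- ι (a ℤ.+ + 1) ℚ.* q p (a ℤ.+ + 1) [mod p ]
lemma4p9 a ℕ.zero       _ _ _ p-prime = ⊥-elim (¬prime[0] p-prime)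
lemma4p9 a p@(ℕ.suc p′) _ _ _ p-prime p≢2 _ p∤a+1 =
  Main.congruence a p′ p-prime (p / 3) (p % 3) (m%n<n p 3) (m≡m%n+[m/n]*n p 3)
    (ModPrime.-1^p≡-1 p′ p-prime p≢2) p∤a+1
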